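{- Let $G$ be a connected unit interval graph on $n$ vertices with lower bounds $\mathrm{lbound}:V(G)\to\mathbb{Q}\cup\{ -\infty\}$, let $\varepsilon=1/K$ with $K\ge n/2$ an integer, fix a partial order $<$ on $V(G)$ as in the context, and let $\mathcal{R}\in\mathfrak{Rep}$. Then the obstruction digraph $H$ of $\mathcal{R}$ is acyclic.
   Context: A unit interval representation of $G$ is an assignment of reals $\ell_v$ such that $uv\in E(G)$ iff $|\ell_u-\ell_v|\le 1$; it is an $\varepsilon$-grid representation if every $\ell_v$ is an integer multiple of $\varepsilon$. Vertices $u,v$ are indistinguishable if $N[u]=N[v]$. The partial order $<$ is fixed so that distinct vertices are comparable iff they are not indistinguishable, and $<$ is the left-to-right order of the intervals of some unit interval representation of $G$. $\mathfrak{Rep}$ is the set of all $\varepsilon$-grid representations of $G$ with $\ell_u<\ell_v$ whenever $u<v$ and $\ell_v\ge\mathrm{lbound}(v)$ for all $v$. For $\mathcal{R}=(\ell_v)\in\mathfrak{Rep}$, a vertex $v_j$ is a left-obstruction of $v_i$ if $v_iv_j\notin E(G)$ and $\ell_j+1+\varepsilon=\ell_i$; $v_j\ne v_i$ is a right-obstruction of $v_i$ if $v_iv_j\in E(G)$ and $\ell_i+1=\ell_j$. The obstruction digraph $H$ has vertex set $V(G)$ and a directed edge $(v_i,v_j)$ iff $v_j$ is an obstruction of $v_i$. -}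

module Defs where

open import Level using (0ℓ)
open import Data.Nat as ℕ using (ℕ; NonZero)
open import Data.Integer as ℤ using (ℤ; +_)
open import Data.Rational as ℚ using (ℚ; _/_; _+_; _-_; ∣_∣; 1ℚ)
open import Data.Fin using (Fin)
open import Data.Maybe using (Maybe; just; nothing)
open import Data.Product using (_×_; ∃; Σ; _,_)
open import Data.Sum using (_⊎_)
open import Data.Unit using (⊤)
open import Data.Empty using (⊥)
open import Relation.Nullary using (¬_)
open import Relation.Binary.PropositionalEquality using (_≡_; _≢_)
open import Relation.Binary.Structures using (IsStrictPartialOrder)
open import Relation.Binary.Construct.Closure.ReflexiveTransitive using (Star)
open import Relation.Binary.Construct.Closure.Transitive using (TransClosure)
open import Function.Bundles using (_⇔_)

record SimpleGraph (n : ℕ) : Set₁ where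
  field
    E     : Fin n → Fin n → Set
    sym   : ∀ {u v} → E u v → E v u
    irrfl : ∀ {u} → ¬ E u u
open SimpleGraph public

module _ {n : ℕ} (G : SimpleGraph n) where

  Connected : Set
  Connected = ∀ u v → Star (E G) u v

  IsUnitIntervalRep : (Fin n → ℚ) → Set
  IsUnitIntervalRep ℓ = ∀ u v → u ≢ v → (E G u v ⇔ (∣ ℓ u - ℓ v ∣ ℚ.≤ 1ℚ))

  IsUnitIntervalGraph : Set
  IsUnitIntervalGraph = ∃ λ (ℓ : Fin n → ℚ) → IsUnitIntervalRep ℓ

  InClosedNbhd : Fin n → Fin n → Set
  InClosedNbhd u w = (w ≡ u) ⊎ E G u w

  Indistinguishable : Fin n → Fin n → Set
  Indistinguishable u v = ∀ w → (InClosedNbhd u w ⇔ InClosedNbhd v w)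

  record AdmissibleOrder (_≺_ : Fin n → Fin n → Set) : Set where
    field
      isSPO      : IsStrictPartialOrder _≡_ _≺_
      comparable : ∀ u v → u ≢ v → ((u ≺ v ⊎ v ≺ u) ⇔ (¬ Indistinguishable u v))
      realised   : ∃ λ (ρ : Fin n → ℚ) → IsUnitIntervalRep ρ × (∀ u v → u ≺ v → ρ u ℚ.< ρ v)

  -- ℓ v ≥ lbound v, where nothing encodes -∞
  AboveLBound : Maybe ℚ → ℚ → Set
  AboveLBound nothing  x = ⊤
  AboveLBound (just q) x = q ℚ.≤ x

  module _ (K : ℕ) .{{_ : NonZero K}} where

    ε : ℚ
    ε = + 1 / K

    OnGrid : ℚ → Set
    OnGrid x = ∃ λ (m : ℤ) → x ≡ m / K

    InRep : (_≺_ : Fin n → Fin n → Set) → (Fin n → Maybe ℚ) → (Fin n → ℚ) → Set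
    InRep _≺_ lbound ℓ =
      IsUnitIntervalRep ℓ ×
      (∀ v → OnGrid (ℓ v)) ×
      (∀ u v → u ≺ v → ℓ u ℚ.< ℓ v) ×
      (∀ v → AboveLBound (lbound v) (ℓ v))

    module _ (ℓ : Fin n → ℚ) where

      LeftObstruction : Fin n → Fin n → Set
      LeftObstruction i j = ¬ E G i j × (ℓ j + 1ℚ + ε ≡ ℓ i)

      RightObstruction : Fin n → Fin n → Set
      RightObstruction i j = (j ≢ i) × E G i j × (ℓ i + 1ℚ ≡ ℓ j)

      ObsEdge : Fin n → Fin n → Set
      ObsEdge i j = LeftObstruction i j ⊎ RightObstruction i j

      ObsAcyclic : Set
      ObsAcyclic = ∀ v → ¬ TransClosure ObsEdge v v

-- An obstruction step moves a vertex's position by -(1 + ε) (left) or by +1 (right); in units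
-- of ε = 1/K these are -(K + 1) and +K. Along a closed walk with a left and b right steps
-- a(K + 1) = bK, and since K and K + 1 are coprime a nonempty such walk has at least
-- 2K + 1 ≥ n + 1 steps. A cycle of H, unrolled forever, is a walk in which some vertex
-- returns within n ≤ 2K steps by the pigeonhole principle, a contradiction.
module Submission where

open import Defs hiding (sym)
open import Data.Nat as ℕ using (ℕ; suc; zero; NonZero; _+_; _*_; _∸_; _<_; _≤_; _≤?_)
open import Data.Nat.Properties
  using ( *-suc; *-monoˡ-≤; +-cancelʳ-≤; +-identityʳ; +-suc; +-mono-≤-<; n≤0⇒n≡0; <-irrefl
        ; ≰⇒>; ≤-<-trans; ≤-trans; <⇒≤; <⇒≱; n<1+n; ≤-pred; m∸n≤m; m∸n+n≡m; m<n⇒0<n∸m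
        ; module ≤-Reasoning)
open import Data.Integer as ℤ using (+_)
open import Data.Integer.Properties using (pos-*; pos-+; +-injective)
  renaming (*-cancelʳ-≡ to ℤ*-cancelʳ-≡; *-comm to ℤ*-comm)
open import Data.Integer.Tactic.RingSolver using (solve-∀)
open import Data.Rational as ℚ using (ℚ; 1ℚ; toℚᵘ)
open import Data.Rational.Properties using (toℚᵘ-homo-+; toℚᵘ-fromℚᵘ; toℚᵘ-cong)
open import Data.Rational.Unnormalised as U using (ℚᵘ; mkℚᵘ; 1ℚᵘ; _≃_; *≡*)
open import Data.Rational.Unnormalised.Properties
  using (≃-refl; +-cong; +-congʳ; +-congˡ; +-assoc; +-comm; +-cancelˡ; +-0-commutativeMonoid; module ≃-Reasoning)
open import Algebra.Bundles using (CommutativeMonoid)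
open import Algebra.Properties.CommutativeSemigroup (CommutativeMonoid.commutativeSemigroup +-0-commutativeMonoid)
  using (xy∙z≈xz∙y; xy∙z≈x∙zy)
open import Data.Fin using (Fin; toℕ)
open import Data.Fin.Properties using (pigeonhole; toℕ<n)
open import Data.Maybe using (Maybe)
open import Data.Product using (∃; ∃₂; _×_; _,_)
open import Data.Sum using (_⊎_; inj₁; inj₂)
open import Data.Empty using (⊥-elim)
open import Relation.Nullary using (yes; no; contradiction)
open import Relation.Binary.PropositionalEquality
  using (_≡_; refl; sym; trans; cong; cong₂; subst; module ≡-Reasoning)
open import Relation.Binary.Construct.Closure.Transitive using (TransClosure; [_]; _∷_)

a*[1+K]≡b*K⇒2K<a+b : ∀ {K a b} → a * suc K ≡ b * K → 0 < a + b → 2 * K < a + b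
a*[1+K]≡b*K⇒2K<a+b {K} {a} {b} eq 0<a+b with b ≤? a
... | yes b≤a = contradiction (subst (0 <_) a+b≡0 0<a+b) (<-irrefl refl)
  where
  open ≤-Reasoning
  a≡0 : a ≡ 0
  a≡0 = n≤0⇒n≡0 (+-cancelʳ-≤ (a * K) a 0 (begin
    a + a * K  ≡⟨ *-suc a K ⟨
    a * suc K  ≡⟨ eq ⟩
    b * K      ≤⟨ *-monoˡ-≤ K b≤a ⟩
    a * K      ∎))
  a+b≡0 : a + b ≡ 0
  a+b≡0 = cong₂ _+_ a≡0 (n≤0⇒n≡0 (subst (b ≤_) a≡0 b≤a))
... | no b≰a = begin-strict
    2 * K  ≡⟨ cong (_+_ K) (+-identityʳ K) ⟩
    K + K  <⟨ +-mono-≤-< K≤a (≤-<-trans K≤a a<b) ⟩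
    a + b  ∎
  where
  open ≤-Reasoning
  a<b : a < b
  a<b = ≰⇒> b≰a
  K≤a : K ≤ a
  K≤a = +-cancelʳ-≤ (a * K) K a (begin
    K + a * K  ≤⟨ *-monoˡ-≤ K a<b ⟩
    b * K      ≡⟨ eq ⟨
    a * suc K  ≡⟨ *-suc a K ⟩
    a + a * K  ∎)

Walk : {A : Set} → (A → A → Set) → (ℕ → A) → Set
Walk R w = ∀ i → R (w i) (w (suc i))

cycle⇒walk : ∀ {A : Set} {R : A → A → Set} {v} → TransClosure R v v → ∃ (Walk R)
cycle⇒walk {A} {R} {v} cycle = unroll cycle , unroll-walk cycle
  where
  unroll : ∀ {x} → TransClosure R x v → ℕ → A
  unroll {x} _    zero    = x
  unroll [ _ ]    (suc i) = unroll cycle i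
  unroll (_ ∷ p)  (suc i) = unroll p i

  unroll-walk : ∀ {x} (p : TransClosure R x v) → Walk R (unroll p)
  unroll-walk [ e ]    zero    = e
  unroll-walk (e ∷ _)  zero    = e
  unroll-walk [ _ ]    (suc i) = unroll-walk cycle i
  unroll-walk (_ ∷ p)  (suc i) = unroll-walk p i

sequence-repeats : ∀ {n} (w : ℕ → Fin n) → ∃₂ λ s d → 0 < d × d ≤ n × w s ≡ w (d + s)
sequence-repeats {n} w with pigeonhole (n<1+n n) (λ i → w (toℕ i))
... | i , j , i<j , wi≡wj =
  toℕ i , toℕ j ∸ toℕ i , m<n⇒0<n∸m i<j ,
  ≤-trans (m∸n≤m (toℕ j) (toℕ i)) (≤-pred (toℕ<n j)) ,
  trans wi≡wj (cong w (sym (m∸n+n≡m (<⇒≤ i<j))))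

module Ticks (k : ℕ) where

  K : ℕ
  K = suc k

  -- ticks x = x / K, as mkℚᵘ stores the denominator minus one.
  ticks : ℕ → ℚᵘ
  ticks x = mkℚᵘ (+ x) k

  ticks-+ : ∀ x y → ticks (x + y) ≃ ticks x U.+ ticks y
  ticks-+ x y = *≡* (begin
    + (x + y) ℤ.* + (K * K)                ≡⟨ cong₂ ℤ._*_ (pos-+ x y) (pos-* K K) ⟩
    (+ x ℤ.+ + y) ℤ.* (+ K ℤ.* + K)        ≡⟨ distrib (+ x) (+ y) (+ K) ⟩
    (+ x ℤ.* + K ℤ.+ + y ℤ.* + K) ℤ.* + K  ∎)
    where
    open ≡-Reasoning
    distrib : ∀ x y z → (x ℤ.+ y) ℤ.* (z ℤ.* z) ≡ (x ℤ.* z ℤ.+ y ℤ.* z) ℤ.* z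
    distrib = solve-∀

  ticks-injective : ∀ {x y} → ticks x ≃ ticks y → x ≡ y
  ticks-injective {x} {y} (*≡* eq) = +-injective (ℤ*-cancelʳ-≡ (+ x) (+ y) (+ K) eq)

  1≃ticks[K] : 1ℚᵘ ≃ ticks K
  1≃ticks[K] = *≡* (ℤ*-comm (+ 1) (+ K))

  1+ε≃ticks[1+K] : 1ℚᵘ U.+ ticks 1 ≃ ticks (suc K)
  1+ε≃ticks[1+K] = begin
    1ℚᵘ U.+ ticks 1     ≈⟨ +-congˡ (ticks 1) 1≃ticks[K] ⟩
    ticks K U.+ ticks 1 ≈⟨ +-comm (ticks K) (ticks 1) ⟩
    ticks 1 U.+ ticks K ≈⟨ ticks-+ 1 K ⟨
    ticks (suc K)       ∎
    where open ≃-Reasoning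

  module _ {A : Set} (h : A → ℚᵘ) where

    HeightSteps : (A → A → Set) → Set
    HeightSteps R = ∀ {x y} → R x y → (h y U.+ ticks (suc K) ≃ h x) ⊎ (h y ≃ h x U.+ ticks K)

    Drift : ℕ → A → A → Set
    Drift d x y = ∃₂ λ a b → a + b ≡ d × h y U.+ ticks (a * suc K) ≃ h x U.+ ticks (b * K)

    drift-step : ∀ {R : A → A → Set} → HeightSteps R →
                 ∀ {d x y z} → Drift d x y → R y z → Drift (suc d) x z
    drift-step steps {x = x} {y} {z} (a , b , a+b≡d , drift) yRz with steps yRz
    ... | inj₁ down = suc a , b , cong suc a+b≡d , (begin
      h z U.+ ticks (suc K + a * suc K)              ≈⟨ +-congʳ (h z) (ticks-+ (suc K) (a * suc K)) ⟩
      h z U.+ (ticks (suc K) U.+ ticks (a * suc K))  ≈⟨ +-assoc (h z) (ticks (suc K)) (ticks (a * suc K)) ⟨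
      (h z U.+ ticks (suc K)) U.+ ticks (a * suc K)  ≈⟨ +-congˡ (ticks (a * suc K)) down ⟩
      h y U.+ ticks (a * suc K)                      ≈⟨ drift ⟩
      h x U.+ ticks (b * K)                          ∎)
      where open ≃-Reasoning
    ... | inj₂ up = a , suc b , trans (+-suc a b) (cong suc a+b≡d) , (begin
      h z U.+ ticks (a * suc K)                ≈⟨ +-congˡ (ticks (a * suc K)) up ⟩
      (h y U.+ ticks K) U.+ ticks (a * suc K)  ≈⟨ xy∙z≈xz∙y (h y) (ticks K) (ticks (a * suc K)) ⟩
      (h y U.+ ticks (a * suc K)) U.+ ticks K  ≈⟨ +-congˡ (ticks K) drift ⟩
      (h x U.+ ticks (b * K)) U.+ ticks K      ≈⟨ xy∙z≈x∙zy (h x) (ticks (b * K)) (ticks K) ⟩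
      h x U.+ (ticks K U.+ ticks (b * K))      ≈⟨ +-congʳ (h x) (ticks-+ K (b * K)) ⟨
      h x U.+ ticks (K + b * K)                ∎)
      where open ≃-Reasoning

    walk-drift : ∀ {R : A → A → Set} → HeightSteps R →
                 ∀ {w} → Walk R w → ∀ s d → Drift d (w s) (w (d + s))
    walk-drift steps walk s zero    = 0 , 0 , refl , ≃-refl
    walk-drift steps walk s (suc d) = drift-step steps (walk-drift steps walk s d) (walk (d + s))

    walk-return-time : ∀ {R : A → A → Set} → HeightSteps R →
                       ∀ {w} → Walk R w → ∀ {s d} → 0 < d → w s ≡ w (d + s) → 2 * K < d
    walk-return-time steps {w} walk {s} {d} 0<d return
      with walk-drift steps walk s d
    ... | a , b , refl , drift =
      a*[1+K]≡b*K⇒2K<a+b {K} {a} {b} (ticks-injective (+-cancelˡ {h (w s)} closed)) 0<d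
      where
      closed : h (w s) U.+ ticks (a * suc K) ≃ h (w s) U.+ ticks (b * K)
      closed = subst (λ v → h v U.+ ticks (a * suc K) ≃ h (w s) U.+ ticks (b * K)) (sym return) drift

module _ {n} (G : SimpleGraph n) (k : ℕ) (ℓ : Fin n → ℚ) where
  open Ticks k
  open ≃-Reasoning

  obstruction-heights : HeightSteps (λ v → toℚᵘ (ℓ v)) (ObsEdge G K ℓ)
  obstruction-heights {i} {j} (inj₁ (_ , left)) = inj₁ (begin
    toℚᵘ (ℓ j) U.+ ticks (suc K)              ≈⟨ +-congʳ (toℚᵘ (ℓ j)) 1+ε≃ticks[1+K] ⟨
    toℚᵘ (ℓ j) U.+ (1ℚᵘ U.+ ticks 1)          ≈⟨ +-assoc (toℚᵘ (ℓ j)) 1ℚᵘ (ticks 1) ⟨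
    (toℚᵘ (ℓ j) U.+ 1ℚᵘ) U.+ ticks 1          ≈⟨ +-cong (toℚᵘ-homo-+ (ℓ j) 1ℚ) (toℚᵘ-fromℚᵘ (ticks 1)) ⟨
    toℚᵘ (ℓ j ℚ.+ 1ℚ) U.+ toℚᵘ (ε G K)        ≈⟨ toℚᵘ-homo-+ (ℓ j ℚ.+ 1ℚ) (ε G K) ⟨
    toℚᵘ (ℓ j ℚ.+ 1ℚ ℚ.+ ε G K)               ≈⟨ toℚᵘ-cong left ⟩
    toℚᵘ (ℓ i)                                ∎)
  obstruction-heights {i} {j} (inj₂ (_ , _ , right)) = inj₂ (begin
    toℚᵘ (ℓ j)                 ≈⟨ toℚᵘ-cong (sym right) ⟩
    toℚᵘ (ℓ i ℚ.+ 1ℚ)          ≈⟨ toℚᵘ-homo-+ (ℓ i) 1ℚ ⟩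
    toℚᵘ (ℓ i) U.+ 1ℚᵘ         ≈⟨ +-congʳ (toℚᵘ (ℓ i)) 1≃ticks[K] ⟩
    toℚᵘ (ℓ i) U.+ ticks K     ∎)

mainTheorem7 : (n : ℕ) (G : SimpleGraph n) → Connected G → IsUnitIntervalGraph G →
               (lbound : Fin n → Maybe ℚ) →
               (K : ℕ) .{{_ : NonZero K}} → n ≤ 2 * K →
               (_≺_ : Fin n → Fin n → Set) → AdmissibleOrder G _≺_ →
               (ℓ : Fin n → ℚ) → InRep G K _≺_ lbound ℓ →
               ObsAcyclic G K ℓ
mainTheorem7 n G _ _ _ zero _ _ _ _ _ = ⊥-elim (ℕ.≢-nonZero⁻¹ 0 refl)
mainTheorem7 n G _ _ _ (suc k) n≤2K _ _ ℓ _ v cycle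
  with cycle⇒walk cycle
... | w , walk with sequence-repeats w
... | s , d , 0<d , d≤n , repeat =
  <⇒≱ (Ticks.walk-return-time k _ {R = ObsEdge G (suc k) ℓ} (obstruction-heights G k ℓ) walk 0<d repeat)
      (≤-trans d≤n n≤2K)
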